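{- The number of (labeled) $n$-vertex graphs with maximum degree at most $\Delta$, where $\Delta=\Omega(\log n)$, is at least $2^{\frac14 n\Delta\log(\frac{n}{\Delta})-2}$.
   Context: Logarithms are base 2. The hypothesis $\Delta=\Omega(\log n)$ means $\Delta\ge c\log n$ for a suitable sufficiently large absolute constant $c$ (with $\Delta\le n-1$). -}

module Defs where

open import Data.Bool using (Bool; true; false; if_then_else_)
open import Data.Bool.Properties using () renaming (_≟_ to _≟ᵇ_)
open import Data.Nat using (ℕ; zero; suc; _≤_; _≤?_)
open import Data.Fin using (Fin)
open import Data.Fin.Properties using (all?)
open import Data.List using (List; []; _∷_; map; concatMap; filter; length; allFin)
open import Data.Nat.ListAction using (sum)
open import Data.Product using (_×_)
open import Relation.Nullary.Decidable using (_×-dec_)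
open import Relation.Binary.PropositionalEquality using (_≡_)
import Data.Vec.Functional as VF

allFns : ∀ {a} {A : Set a} (k : ℕ) → List A → List (Fin k → A)
allFns zero    xs = (λ ()) ∷ []
allFns (suc k) xs = concatMap (λ x → map (λ f → x VF.∷ f) (allFns k xs)) xs

Adj : ℕ → Set
Adj n = Fin n → Fin n → Bool

-- All 2^(n²) adjacency matrices on Fin n (each exactly once).
allAdj : (n : ℕ) → List (Adj n)
allAdj n = allFns n (allFns n (true ∷ false ∷ []))

IsGraph : ∀ {n} → Adj n → Set
IsGraph {n} A = (∀ u v → A u v ≡ A v u) × (∀ u → A u u ≡ false)

deg : ∀ {n} → Adj n → Fin n → ℕ
deg {n} A u = sum (map (λ v → if A u v then 1 else 0) (allFin n))

MaxDegLe : ∀ {n} → ℕ → Adj n → Set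
MaxDegLe Δ A = ∀ u → deg A u ≤ Δ

GoodGraph : ∀ {n} → ℕ → Adj n → Set
GoodGraph Δ A = IsGraph A × MaxDegLe Δ A

goodGraph? : ∀ {n} (Δ : ℕ) (A : Adj n) → Relation.Nullary.Decidable.Dec (GoodGraph Δ A)
goodGraph? Δ A =
  (all? (λ u → all? (λ v → A u v ≟ᵇ A v u)) ×-dec all? (λ u → A u u ≟ᵇ false))
  ×-dec all? (λ u → deg A u ≤? Δ)

numGraphs : ℕ → ℕ → ℕ
numGraphs n Δ = length (filter (goodGraph? Δ) (allAdj n))

module Submission where

open import Defs
open import Data.Bool using (Bool; true; false; if_then_else_)
open import Data.Empty using (⊥; ⊥-elim)
open import Data.Fin using (Fin; zero; suc; toℕ; fromℕ<)
open import Data.Fin.Properties using (toℕ-fromℕ<)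
open import Data.List using (List; []; _∷_; map; _++_; concatMap; filter; length; upTo; applyUpTo; tabulate; allFin)
open import Data.List.Properties using (length-++; length-map; length-upTo; map-cong; map-tabulate)
open import Data.List.Relation.Unary.All as All using (All; []; _∷_; all?)
import Data.List.Relation.Unary.All.Properties as Allₚ
open import Data.List.Relation.Unary.Any as Any using (Any; here; there)
import Data.List.Relation.Unary.Any.Properties as Anyₚ
open import Data.List.Relation.Unary.AllPairs as AllPairs using (AllPairs; []; _∷_)
import Data.List.Relation.Unary.AllPairs.Properties as AllPairsₚ
open import Data.Nat
open import Data.Nat.Properties
open import Data.Nat.DivMod
open import Data.Nat.Divisibility using (n∣m*n)
open import Data.Nat.ListAction using (sum)
open import Data.Nat.Solver using (module +-*-Solver)
open import Data.Product using (∃-syntax; _×_; _,_; proj₁; proj₂)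
open import Data.Sum using (_⊎_; inj₁; inj₂)
open import Function using (_⇔_; mk⇔; Equivalence; _∘_)
open import Relation.Binary.PropositionalEquality
open import Relation.Nullary using (¬_; Dec; yes; no; does; _×-dec_; _⊎-dec_; contradiction)
open import Relation.Nullary.Decidable using (dec-true; dec-false; does-⇔; toWitness)
open import Relation.Unary using (Decidable)
import Data.Vec.Functional as VF

open +-*-Solver using (solve; _:*_; _:+_; con; _:=_)

-- Split B·s of the vertices into B blocks of s vertices and join every two blocks by a matching:
-- the perfect matching of a permutation of the block (s! choices) or a part of the identity matching
-- (2^s choices). Every vertex then has at most B - 1 ≤ Δ neighbours, and different choices give
-- different graphs, so there are at least F^(B(B-1)/2) graphs of maximum degree at most Δ, where
-- F ∈ {s!, 2^s}. If n ≥ 7(Δ+1), take B = Δ + 1 blocks of size s = ⌊n/(Δ+1)⌋ ≥ 7 and permutations;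
-- a Stirling-type bound on s! gives F^(2B(B-1)) ≥ (n/Δ)^(nΔ). Otherwise n/Δ ≈ a/6 with 6 ≤ a < 48;
-- blocks of size s ≤ 8 depending on a reduce the claim to finitely many numerical inequalities.

-- Sums and products over initial segments

∑< : ℕ → (ℕ → ℕ) → ℕ
∑< zero    f = 0
∑< (suc k) f = f 0 + ∑< k (λ i → f (suc i))

∑<-cong : ∀ k {f g : ℕ → ℕ} → (∀ i → i < k → f i ≡ g i) → ∑< k f ≡ ∑< k g
∑<-cong zero    h = refl
∑<-cong (suc k) h = cong₂ _+_ (h 0 z<s) (∑<-cong k (λ i i<k → h (suc i) (s<s i<k)))

∑<-mono-≤ : ∀ k {f g : ℕ → ℕ} → (∀ i → i < k → f i ≤ g i) → ∑< k f ≤ ∑< k g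
∑<-mono-≤ zero    h = z≤n
∑<-mono-≤ (suc k) h = +-mono-≤ (h 0 z<s) (∑<-mono-≤ k (λ i i<k → h (suc i) (s<s i<k)))

∑<-zero : ∀ k {f : ℕ → ℕ} → (∀ i → i < k → f i ≡ 0) → ∑< k f ≡ 0
∑<-zero zero    h = refl
∑<-zero (suc k) h = cong₂ _+_ (h 0 z<s) (∑<-zero k (λ i i<k → h (suc i) (s<s i<k)))

∑<-+ : ∀ a b (f : ℕ → ℕ) → ∑< (a + b) f ≡ ∑< a f + ∑< b (λ i → f (a + i))
∑<-+ zero    b f = refl
∑<-+ (suc a) b f = trans (cong (f 0 +_) (∑<-+ a b (λ i → f (suc i)))) (sym (+-assoc (f 0) _ _))

∑<-blocks : ∀ B s (f : ℕ → ℕ) → ∑< (B * s) f ≡ ∑< B (λ J → ∑< s (λ q → f (J * s + q)))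
∑<-blocks zero    s f = refl
∑<-blocks (suc B) s f = trans (∑<-+ s (B * s) f)
  (cong (∑< s f +_) (trans (∑<-blocks B s (λ i → f (s + i)))
    (∑<-cong B (λ J _ → ∑<-cong s (λ q _ → cong f (sym (+-assoc s (J * s) q)))))))

sum-allFin : ∀ k (f : ℕ → ℕ) → sum (map (λ v → f (toℕ v)) (allFin k)) ≡ ∑< k f
sum-allFin k f = trans (cong sum (map-tabulate {n = k} (λ v → v) (λ v → f (toℕ v)))) (go k f)
  where
  go : ∀ k (f : ℕ → ℕ) → sum (tabulate {n = k} (λ v → f (toℕ v))) ≡ ∑< k f
  go zero    f = refl
  go (suc k) f = cong (f 0 +_) (go k (λ i → f (suc i)))

indicator : Bool → ℕ
indicator b = if b then 1 else 0

∑<-indicator-≤1 : ∀ {P : ℕ → Set} (P? : ∀ q → Dec (P q)) k →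
                  (∀ {q q′} → q < k → q′ < k → P q → P q′ → q ≡ q′) →
                  ∑< k (λ q → indicator (does (P? q))) ≤ 1
∑<-indicator-≤1 P? zero    unique = z≤n
∑<-indicator-≤1 P? (suc k) unique with P? 0
... | yes p0 = ≤-reflexive (cong suc (∑<-zero k none))
  where
  none : ∀ i → i < k → indicator (does (P? (suc i))) ≡ 0
  none i i<k with P? (suc i)
  ... | yes pi = ⊥-elim (1+n≢0 (sym (unique z<s (s<s i<k) p0 pi)))
  ... | no _   = refl
... | no _   = ∑<-indicator-≤1 (λ q → P? (suc q)) k
                 (λ q< q′< p p′ → suc-injective (unique (s<s q<) (s<s q′<) p p′))

∑<-≤-pred : ∀ k (f : ℕ → ℕ) {i} → i < k → f i ≡ 0 → (∀ j → j < k → f j ≤ 1) → ∑< k f ≤ k ∸ 1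
∑<-≤-pred (suc k) f {zero} _ f0 h = begin
  f 0 + ∑< k (λ j → f (suc j)) ≡⟨ cong (_+ ∑< k (λ j → f (suc j))) f0 ⟩
  ∑< k (λ j → f (suc j))       ≤⟨ ∑<-mono-≤ k (λ j j<k → h (suc j) (s<s j<k)) ⟩
  ∑< k (λ _ → 1)               ≡⟨ ∑<-const k ⟩
  k                            ∎
  where
  open ≤-Reasoning
  ∑<-const : ∀ k → ∑< k (λ _ → 1) ≡ k
  ∑<-const zero    = refl
  ∑<-const (suc k) = cong suc (∑<-const k)
∑<-≤-pred (suc (suc k)) f {suc i} (s<s i<k) fi h =
  +-mono-≤ (h 0 z<s) (∑<-≤-pred (suc k) (λ j → f (suc j)) i<k fi (λ j j< → h (suc j) (s<s j<)))

∏< : ℕ → (ℕ → ℕ) → ℕ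
∏< zero    f = 1
∏< (suc k) f = f 0 * ∏< k (λ i → f (suc i))

∏<-cong : ∀ k {f g : ℕ → ℕ} → (∀ i → i < k → f i ≡ g i) → ∏< k f ≡ ∏< k g
∏<-cong zero    h = refl
∏<-cong (suc k) h = cong₂ _*_ (h 0 z<s) (∏<-cong k (λ i i<k → h (suc i) (s<s i<k)))

∏<-last : ∀ k (f : ℕ → ℕ) → ∏< (suc k) f ≡ ∏< k f * f k
∏<-last zero    f = trans (*-identityʳ (f 0)) (sym (+-identityʳ (f 0)))
∏<-last (suc k) f = trans (cong (f 0 *_) (∏<-last k (λ i → f (suc i)))) (sym (*-assoc (f 0) _ _))

∏<-suc≡! : ∀ k → ∏< k suc ≡ k !
∏<-suc≡! zero    = refl
∏<-suc≡! (suc k) = begin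
  ∏< (suc k) suc ≡⟨ ∏<-last k suc ⟩
  ∏< k suc * suc k ≡⟨ cong (_* suc k) (∏<-suc≡! k) ⟩
  k ! * suc k     ≡⟨ *-comm (k !) (suc k) ⟩
  suc k !         ∎
  where open ≡-Reasoning

∏<-const : ∀ k a → ∏< k (λ _ → a) ≡ a ^ k
∏<-const zero    a = refl
∏<-const (suc k) a = cong (a *_) (∏<-const k a)

∏<-^ : ∀ k a (h : ℕ → ℕ) → ∏< k (λ i → a ^ h i) ≡ a ^ ∑< k h
∏<-^ zero    a h = refl
∏<-^ (suc k) a h = trans (cong (a ^ h 0 *_) (∏<-^ k a (λ i → h (suc i)))) (sym (^-distribˡ-+-* a (h 0) _))

∏<-above : ∀ a i k → ∏< k (λ j → if does (i <? j) then a else 1) ≡ a ^ (k ∸ suc i)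
∏<-above a i zero    = refl
∏<-above a i (suc k) = trans (∏<-last k g) (last (i <? k))
  where
  g = λ j → if does (i <? j) then a else 1
  last : (d : Dec (i < k)) → ∏< k g * (if does d then a else 1) ≡ a ^ (suc k ∸ suc i)
  last (yes i<k) = begin
    ∏< k g * a          ≡⟨ cong (_* a) (∏<-above a i k) ⟩
    a ^ (k ∸ suc i) * a ≡⟨ *-comm (a ^ (k ∸ suc i)) a ⟩
    a ^ suc (k ∸ suc i) ≡⟨ cong (a ^_) (sym (+-∸-assoc 1 i<k)) ⟩
    a ^ (k ∸ i)         ∎
    where open ≡-Reasoning
  last (no i≮k) = begin
    ∏< k g * 1          ≡⟨ *-identityʳ _ ⟩
    ∏< k g              ≡⟨ ∏<-above a i k ⟩
    a ^ (k ∸ suc i)     ≡⟨ cong (a ^_) (m≤n⇒m∸n≡0 (m≤n⇒m≤1+n k≤i)) ⟩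
    1                   ≡⟨ cong (a ^_) (sym (m≤n⇒m∸n≡0 k≤i)) ⟩
    a ^ (k ∸ i)         ∎
    where
    open ≡-Reasoning
    k≤i = ≮⇒≥ i≮k

pairs : ℕ → ℕ
pairs B = ∑< B (λ I → B ∸ suc I)

2*pairs : ∀ B → 2 * pairs B ≡ B * (B ∸ 1)
2*pairs zero          = refl
2*pairs (suc zero)    = refl
2*pairs (suc (suc b)) = begin
  2 * (suc b + pairs (suc b))   ≡⟨ *-distribˡ-+ 2 (suc b) (pairs (suc b)) ⟩
  2 * suc b + 2 * pairs (suc b) ≡⟨ cong (2 * suc b +_) (2*pairs (suc b)) ⟩
  2 * suc b + suc b * b         ≡⟨ solve 1 (λ b → con 2 :* (con 1 :+ b) :+ (con 1 :+ b) :* b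
                                                := (con 2 :+ b) :* (con 1 :+ b)) refl b ⟩
  suc (suc b) * suc b           ∎
  where open ≡-Reasoning

-- Enumerating sequences, and counting by injections

_∷ⁿ_ : ∀ {A : Set} → A → (ℕ → A) → ℕ → A
(x ∷ⁿ f) zero    = x
(x ∷ⁿ f) (suc i) = f i

-- Entries from index k on are the padding value d.
choices : ∀ {A : Set} → A → (k : ℕ) → (ℕ → List A) → List (ℕ → A)
choices d zero    X = (λ _ → d) ∷ []
choices d (suc k) X = concatMap (λ x → map (x ∷ⁿ_) (choices d k (λ i → X (suc i)))) (X 0)

length-concatMap-map : ∀ {A B C : Set} (f : A → B → C) (ys : List B) (xs : List A) →
                       length (concatMap (λ x → map (f x) ys) xs) ≡ length xs * length ys
length-concatMap-map f ys []       = refl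
length-concatMap-map f ys (x ∷ xs) = begin
  length (map (f x) ys ++ concatMap (λ x → map (f x) ys) xs)
    ≡⟨ length-++ (map (f x) ys) ⟩
  length (map (f x) ys) + length (concatMap (λ x → map (f x) ys) xs)
    ≡⟨ cong₂ _+_ (length-map (f x) ys) (length-concatMap-map f ys xs) ⟩
  length ys + length xs * length ys ∎
  where open ≡-Reasoning

length-choices : ∀ {A : Set} (d : A) k X → length (choices d k X) ≡ ∏< k (λ i → length (X i))
length-choices d zero    X = refl
length-choices d (suc k) X =
  trans (length-concatMap-map _∷ⁿ_ (choices d k (λ i → X (suc i))) (X 0))
        (cong (length (X 0) *_) (length-choices d k (λ i → X (suc i))))

choices-All : ∀ {A : Set} {P : ℕ → A → Set} (d : A) k X → (∀ i → i < k → All (P i) (X i)) →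
              All (λ f → ∀ i → i < k → P i (f i)) (choices d k X)
choices-All d zero    X h = (λ _ ()) ∷ []
choices-All {P = P} d (suc k) X h = Allₚ.concat⁺ (Allₚ.map⁺ (go (X 0) (h 0 z<s)))
  where
  rest = choices-All {P = λ i → P (suc i)} d k (λ i → X (suc i)) (λ i i<k → h (suc i) (s<s i<k))
  go : ∀ xs → All (P 0) xs →
       All (λ x → All (λ f → ∀ i → i < suc k → P i (f i)) (map (x ∷ⁿ_) (choices d k (λ i → X (suc i))))) xs
  go []       []         = []
  go (x ∷ xs) (px ∷ pxs) =
    Allₚ.map⁺ (All.map (λ pf → λ { zero _ → px ; (suc i) i<k → pf i (s<s⁻¹ i<k) }) rest) ∷ go xs pxs

ApartBelow : ∀ {A : Set} → ℕ → (A → A → Set) → (ℕ → A) → (ℕ → A) → Set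
ApartBelow k R f g = ∃[ i ] (i < k × R (f i) (g i))

choices-AllPairs : ∀ {A : Set} {R : A → A → Set} (d : A) k X → (∀ i → i < k → AllPairs R (X i)) →
                   AllPairs (ApartBelow k R) (choices d k X)
choices-AllPairs d zero    X h = [] ∷ []
choices-AllPairs {A} {R} d (suc k) X h = go (X 0) (h 0 z<s)
  where
  F = choices d k (λ i → X (suc i))
  rest : AllPairs (ApartBelow k R) F
  rest = choices-AllPairs d k (λ i → X (suc i)) (λ i i<k → h (suc i) (s<s i<k))
  block : List A → List (ℕ → A)
  block = concatMap (λ x → map (x ∷ⁿ_) F)
  heads : ∀ {x} ys → All (R x) ys → All (λ g → R x (g 0)) (block ys)
  heads []       []       = []
  heads (y ∷ ys) (r ∷ rs) = Allₚ.++⁺ (Allₚ.map⁺ (All.universal (λ _ → r) F)) (heads ys rs)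
  shift : ∀ {x} {fs} → AllPairs (ApartBelow k R) fs → AllPairs (ApartBelow (suc k) R) (map (x ∷ⁿ_) fs)
  shift fs = AllPairsₚ.map⁺ (AllPairs.map (λ { (i , i<k , r) → suc i , s<s i<k , r }) fs)
  go : ∀ ys → AllPairs R ys → AllPairs (ApartBelow (suc k) R) (block ys)
  go []       []         = []
  go (y ∷ ys) (ry ∷ rys) = AllPairsₚ.++⁺ (shift rest) (go ys rys)
    (Allₚ.map⁺ (All.universal (λ _ → All.map (λ r → 0 , z<s , r) (heads ys ry)) F))

allFns-complete : ∀ {A B : Set} k (R : B → A → Set) (xs : List A) (f : Fin k → B) →
                  (∀ i → Any (R (f i)) xs) → Any (λ g → ∀ i → R (f i) (g i)) (allFns k xs)
allFns-complete zero    R xs f h = here (λ ())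
allFns-complete (suc k) R xs f h = go xs (h zero)
  where
  F = allFns k xs
  rest = allFns-complete k R xs (λ i → f (suc i)) (λ i → h (suc i))
  go : ∀ ys → Any (R (f zero)) ys → Any (λ g → ∀ i → R (f i) (g i)) (concatMap (λ x → map (x VF.∷_) F) ys)
  go (y ∷ ys) (here r)  = Anyₚ.++⁺ˡ (Anyₚ.map⁺ (Any.map (λ p → λ { zero → r ; (suc i) → p i }) rest))
  go (y ∷ ys) (there a) = Anyₚ.++⁺ʳ (map (y VF.∷_) F) (go ys a)

Any-filter⁺ : ∀ {A : Set} {P Q : A → Set} (P? : Decidable P) {xs} →
              (∀ {x} → Q x → P x) → Any Q xs → Any Q (filter P? xs)
Any-filter⁺ P? Q⇒P q with Anyₚ.filter⁺ P? q
... | inj₁ q′ = q′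
... | inj₂ ¬p = ⊥-elim (¬p (Q⇒P (Anyₚ.lookup-result q)))

removeAny : ∀ {A : Set} {P : A → Set} (ys : List A) → Any P ys → List A
removeAny (y ∷ ys) (here _)  = ys
removeAny (y ∷ ys) (there p) = y ∷ removeAny ys p

length-removeAny : ∀ {A : Set} {P : A → Set} ys (p : Any P ys) → length ys ≡ suc (length (removeAny ys p))
length-removeAny (y ∷ ys) (here _)  = refl
length-removeAny (y ∷ ys) (there p) = cong suc (length-removeAny ys p)

removeAny-keeps : ∀ {A : Set} {P Q : A → Set} ys (p : Any P ys) → (∀ {z} → P z → Q z → ⊥) →
                  Any Q ys → Any Q (removeAny ys p)
removeAny-keeps (y ∷ ys) (here p)  P∩Q (here q)  = ⊥-elim (P∩Q p q)
removeAny-keeps (y ∷ ys) (here p)  P∩Q (there q) = q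
removeAny-keeps (y ∷ ys) (there p) P∩Q (here q)  = here q
removeAny-keeps (y ∷ ys) (there p) P∩Q (there q) = there (removeAny-keeps ys p P∩Q q)

injection-length : ∀ {A B : Set} (_~_ : A → B → Set) {xs : List A} {ys : List B} →
                   All (λ x → Any (x ~_) ys) xs →
                   AllPairs (λ x x′ → ∀ {y} → x ~ y → x′ ~ y → ⊥) xs →
                   length xs ≤ length ys
injection-length _~_ []               _            = z≤n
injection-length _~_ {ys = ys} (p ∷ ps) (disj ∷ disjs) =
  subst (_ ≤_) (sym (length-removeAny ys p))
    (s≤s (injection-length _~_ (keep ps disj) disjs))
  where
  keep : ∀ {xs} → All (λ x → Any (x ~_) ys) xs → All (λ x′ → ∀ {y} → _ ~ y → x′ ~ y → ⊥) xs →
         All (λ x → Any (x ~_) (removeAny ys p)) xs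
  keep []       []       = []
  keep (q ∷ qs) (d ∷ ds) = removeAny-keeps ys p d q ∷ keep qs ds

-- Fisher–Yates codes

transpose : ℕ → ℕ → ℕ → ℕ
transpose a b x with x ≟ a
... | yes _ = b
... | no _ with x ≟ b
...   | yes _ = a
...   | no _  = x

transpose-a : ∀ a b → transpose a b a ≡ b
transpose-a a b with a ≟ a
... | yes _   = refl
... | no a≢a  = ⊥-elim (a≢a refl)

transpose-b : ∀ a b → transpose a b b ≡ a
transpose-b a b with b ≟ a
... | yes b≡a = b≡a
... | no _ with b ≟ b
...   | yes _  = refl
...   | no b≢b = ⊥-elim (b≢b refl)

transpose-other : ∀ {a b x} → x ≢ a → x ≢ b → transpose a b x ≡ x
transpose-other {a} {b} {x} x≢a x≢b with x ≟ a
... | yes x≡a = ⊥-elim (x≢a x≡a)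
... | no _ with x ≟ b
...   | yes x≡b = ⊥-elim (x≢b x≡b)
...   | no _    = refl

transpose-involutive : ∀ a b x → transpose a b (transpose a b x) ≡ x
transpose-involutive a b x = by-cases (x ≟ a) (x ≟ b)
  where
  by-cases : Dec (x ≡ a) → Dec (x ≡ b) → transpose a b (transpose a b x) ≡ x
  by-cases (yes refl) _          = trans (cong (transpose x b) (transpose-a x b)) (transpose-b x b)
  by-cases (no _)     (yes refl) = trans (cong (transpose a x) (transpose-b a x)) (transpose-a a x)
  by-cases (no x≢a)   (no x≢b)   =
    trans (cong (transpose a b) (transpose-other x≢a x≢b)) (transpose-other x≢a x≢b)

transpose-injective : ∀ a b {x y} → transpose a b x ≡ transpose a b y → x ≡ y
transpose-injective a b {x} {y} eq =
  trans (sym (transpose-involutive a b x)) (trans (cong (transpose a b) eq) (transpose-involutive a b y))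

transpose-≤ : ∀ {a b x m} → a ≤ m → b ≤ m → x ≤ m → transpose a b x ≤ m
transpose-≤ {a} {b} {x} a≤m b≤m x≤m with x ≟ a
... | yes _ = b≤m
... | no _ with x ≟ b
...   | yes _ = a≤m
...   | no _  = x≤m

-- The Fisher–Yates encoding of permutations of {0, …, k-1}: a code c with c i ≤ i
-- stands for the product of the transpositions (i, c i), i < k.
fisherYates : ℕ → (ℕ → ℕ) → ℕ → ℕ
fisherYates zero    c x = x
fisherYates (suc k) c x = transpose k (c k) (fisherYates k c x)

FYCode : ℕ → (ℕ → ℕ) → Set
FYCode k c = ∀ i → i < k → c i ≤ i

FYCode-pred : ∀ {k c} → FYCode (suc k) c → FYCode k c
FYCode-pred code i i<k = code i (m<n⇒m<1+n i<k)

fisherYates-injective : ∀ k c {x y} → fisherYates k c x ≡ fisherYates k c y → x ≡ y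
fisherYates-injective zero    c eq = eq
fisherYates-injective (suc k) c eq = fisherYates-injective k c (transpose-injective k (c k) eq)

fisherYates-fixes : ∀ k {c} → FYCode k c → ∀ {x} → k ≤ x → fisherYates k c x ≡ x
fisherYates-fixes zero    code k≤x = refl
fisherYates-fixes (suc k) {c} code {x} k<x =
  trans (cong (transpose k (c k)) (fisherYates-fixes k (FYCode-pred code) (<⇒≤ k<x)))
        (transpose-other (λ x≡k → <-irrefl (sym x≡k) k<x)
                         (λ x≡ck → <-irrefl (sym x≡ck) (≤-<-trans (code k ≤-refl) k<x)))

fisherYates-< : ∀ k {c} → FYCode k c → ∀ {x} → x < k → fisherYates k c x < k
fisherYates-< (suc k) {c} code {x} x<1+k with x <? k
... | yes x<k = s≤s (transpose-≤ ≤-refl (code k ≤-refl) (<⇒≤ (fisherYates-< k (FYCode-pred code) x<k)))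
... | no x≮k rewrite ≤-antisym (s≤s⁻¹ x<1+k) (≮⇒≥ x≮k)
                   | fisherYates-fixes k (FYCode-pred code) (≤-refl {k})
                   | transpose-a k (c k) = s≤s (code k ≤-refl)

-- The code is read off backwards: the last transposition sends k to c k.
fisherYates-last-code : ∀ k {c c′} → FYCode (suc k) c → FYCode (suc k) c′ →
                        fisherYates (suc k) c k ≡ fisherYates (suc k) c′ k → c k ≡ c′ k
fisherYates-last-code k {c} {c′} code code′ same = begin
  c k                      ≡⟨ sym (transpose-a k (c k)) ⟩
  transpose k (c k) k      ≡⟨ cong (transpose k (c k)) (sym (fisherYates-fixes k (FYCode-pred code) ≤-refl)) ⟩
  fisherYates (suc k) c k  ≡⟨ same ⟩
  fisherYates (suc k) c′ k ≡⟨ cong (transpose k (c′ k)) (fisherYates-fixes k (FYCode-pred code′) ≤-refl) ⟩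
  transpose k (c′ k) k     ≡⟨ transpose-a k (c′ k) ⟩
  c′ k                     ∎
  where open ≡-Reasoning

fisherYates-code-unique : ∀ k {c c′} → FYCode k c → FYCode k c′ →
                          (∀ x → x < k → fisherYates k c x ≡ fisherYates k c′ x) →
                          ∀ i → i < k → c i ≡ c′ i
fisherYates-code-unique (suc k) {c} {c′} code code′ same i i<1+k with i <? k
... | yes i<k = fisherYates-code-unique k (FYCode-pred code) (FYCode-pred code′) same-below i i<k
  where
  last = fisherYates-last-code k code code′ (same k ≤-refl)
  same-below : ∀ x → x < k → fisherYates k c x ≡ fisherYates k c′ x
  same-below x x<k = begin
    fisherYates k c x                             ≡⟨ sym (transpose-involutive k (c k) _) ⟩
    transpose k (c k) (fisherYates (suc k) c x)   ≡⟨ cong₂ (transpose k) last (same x (m<n⇒m<1+n x<k)) ⟩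
    transpose k (c′ k) (fisherYates (suc k) c′ x) ≡⟨ transpose-involutive k (c′ k) _ ⟩
    fisherYates k c′ x                            ∎
    where open ≡-Reasoning
... | no i≮k rewrite ≤-antisym (s≤s⁻¹ i<1+k) (≮⇒≥ i≮k) = fisherYates-last-code k code code′ (same k ≤-refl)

-- Block graphs

does-≡⇒→ : ∀ {A B : Set} (a? : Dec A) (b? : Dec B) → does a? ≡ does b? → A → B
does-≡⇒→ a? (yes b) _  _ = b
does-≡⇒→ a? (no ¬b) eq a with () ← trans (sym (dec-true a? a)) eq

-- How two blocks of size s are joined: by the perfect matching of a permutation
-- (Fisher–Yates code), or by a subset of the identity matching (0/1 code).
data Linking : Set where
  permutation subIdentity : Linking

linkBound : Linking → ℕ → ℕ
linkBound permutation p = p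
linkBound subIdentity p = 1

linkCount : Linking → ℕ → ℕ
linkCount permutation s = s !
linkCount subIdentity s = 2 ^ s

∏<-linkBound : ∀ m s → ∏< s (λ p → suc (linkBound m p)) ≡ linkCount m s
∏<-linkBound permutation s = ∏<-suc≡! s
∏<-linkBound subIdentity s = ∏<-const s 2

module Links (s : ℕ) where

  ValidLink : Linking → (ℕ → ℕ) → Set
  ValidLink m c = ∀ p → p < s → c p ≤ linkBound m p

  Linked : Linking → (ℕ → ℕ) → ℕ → ℕ → Set
  Linked permutation c p q = fisherYates s c p ≡ q
  Linked subIdentity c p q = p ≡ q × c p ≡ 1

  linked? : ∀ m c p q → Dec (Linked m c p q)
  linked? permutation c p q = fisherYates s c p ≟ q
  linked? subIdentity c p q = (p ≟ q) ×-dec (c p ≟ 1)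

  Linked-functional : ∀ m {c p q q′} → Linked m c p q → Linked m c p q′ → q ≡ q′
  Linked-functional permutation refl       refl        = refl
  Linked-functional subIdentity (refl , _) (refl , _)  = refl

  Linked-injective : ∀ m {c p p′ q} → Linked m c p q → Linked m c p′ q → p ≡ p′
  Linked-injective permutation {c} e e′ = fisherYates-injective s c (trans e (sym e′))
  Linked-injective subIdentity (refl , _) (refl , _) = refl

  Linked-determines-code : ∀ m {c c′} → ValidLink m c → ValidLink m c′ →
                           (∀ p q → p < s → q < s → Linked m c p q ⇔ Linked m c′ p q) →
                           ∀ p → p < s → c p ≡ c′ p
  Linked-determines-code permutation {c} {c′} valid valid′ same =
    fisherYates-code-unique s valid valid′ λ p p<s →
      sym (Equivalence.to (same p (fisherYates s c p) p<s (fisherYates-< s valid p<s)) refl)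
  Linked-determines-code subIdentity valid valid′ same p p<s =
    bits-equal (valid p p<s) (valid′ p p<s)
      (λ e → proj₂ (Equivalence.to (same p p p<s p<s) (refl , e)))
      (λ e → proj₂ (Equivalence.from (same p p p<s p<s) (refl , e)))
    where
    bits-equal : ∀ {a b} → a ≤ 1 → b ≤ 1 → (a ≡ 1 → b ≡ 1) → (b ≡ 1 → a ≡ 1) → a ≡ b
    bits-equal z≤n       z≤n       _   _   = refl
    bits-equal z≤n       (s≤s z≤n) _   b⇒a = b⇒a refl
    bits-equal (s≤s z≤n) z≤n       a⇒b _   = sym (a⇒b refl)
    bits-equal (s≤s z≤n) (s≤s z≤n) _   _   = refl

GoodGraph-resp : ∀ {n Δ} {A A′ : Adj n} → (∀ u v → A u v ≡ A′ u v) → GoodGraph Δ A → GoodGraph Δ A′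
GoodGraph-resp {n} eq ((sym-A , irrefl-A) , deg-A) =
  ((λ u v → trans (sym (eq u v)) (trans (sym-A u v) (eq v u))) , (λ u → trans (sym (eq u u)) (irrefl-A u))) ,
  (λ u → subst (_≤ _) (cong sum (map-cong (λ v → cong (λ b → if b then 1 else 0) (eq u v)) (allFin n))) (deg-A u))

module BlockIndexing (s : ℕ) .{{_ : NonZero s}} where

  [J*s+q]/s≡J : ∀ J {q} → q < s → (J * s + q) / s ≡ J
  [J*s+q]/s≡J J {q} q<s = begin
    (J * s + q) / s   ≡⟨ +-distrib-/-∣ˡ q (n∣m*n J) ⟩
    J * s / s + q / s ≡⟨ cong₂ _+_ (m*n/n≡m J s) (m<n⇒m/n≡0 q<s) ⟩
    J + 0             ≡⟨ +-identityʳ J ⟩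
    J                 ∎
    where open ≡-Reasoning

  [J*s+q]%s≡q : ∀ J {q} → q < s → (J * s + q) % s ≡ q
  [J*s+q]%s≡q J {q} q<s = trans (cong (_% s) (+-comm (J * s) q)) (trans ([m+kn]%n≡m%n q J s) (m<n⇒m%n≡m q<s))

  J*s+q<B*s : ∀ {B J q} → J < B → q < s → J * s + q < B * s
  J*s+q<B*s {B} {J} {q} J<B q<s = begin-strict
    J * s + q <⟨ +-monoʳ-< (J * s) q<s ⟩
    J * s + s ≡⟨ +-comm (J * s) s ⟩
    suc J * s ≤⟨ *-monoˡ-≤ s J<B ⟩
    B * s     ∎
    where open ≤-Reasoning

-- Vertex u < B * s is vertex u % s of block u / s; vertices from B * s on are isolated. Blocks I < J
-- are joined as prescribed by c I J, so a vertex has at most one neighbour in each other block.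
module Blocks (s B : ℕ) .{{_ : NonZero s}} where
  open Links s
  open BlockIndexing s

  Code : Set
  Code = ℕ → ℕ → ℕ → ℕ

  BlockAdjacent : Linking → Code → ℕ → ℕ → ℕ → ℕ → Set
  BlockAdjacent m c I p J q = (I < J × Linked m (c I J) p q) ⊎ (J < I × Linked m (c J I) q p)

  Adjacent : Linking → Code → ℕ → ℕ → Set
  Adjacent m c u v = u < B * s × v < B * s × BlockAdjacent m c (u / s) (u % s) (v / s) (v % s)

  adjacent? : ∀ m c u v → Dec (Adjacent m c u v)
  adjacent? m c u v = (u <? B * s) ×-dec (v <? B * s) ×-dec
    (((u / s <? v / s) ×-dec linked? m _ _ _) ⊎-dec ((v / s <? u / s) ×-dec linked? m _ _ _))

  BlockAdjacent-irrefl : ∀ {m c I p q} → ¬ BlockAdjacent m c I p I q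
  BlockAdjacent-irrefl (inj₁ (I<I , _)) = <-irrefl refl I<I
  BlockAdjacent-irrefl (inj₂ (I<I , _)) = <-irrefl refl I<I

  Adjacent-sym : ∀ {m c u v} → Adjacent m c u v → Adjacent m c v u
  Adjacent-sym (u< , v< , inj₁ adj) = v< , u< , inj₂ adj
  Adjacent-sym (u< , v< , inj₂ adj) = v< , u< , inj₁ adj

  Adjacent-irrefl : ∀ {m c u} → ¬ Adjacent m c u u
  Adjacent-irrefl {m} {c} (_ , _ , adj) = BlockAdjacent-irrefl {m} {c} adj

  Adjacent-block : ∀ m c {u} J {q} → q < s → Adjacent m c u (J * s + q) → BlockAdjacent m c (u / s) (u % s) J q
  Adjacent-block m c {u} J q<s (_ , _ , adj) =
    subst₂ (BlockAdjacent m c (u / s) (u % s)) ([J*s+q]/s≡J J q<s) ([J*s+q]%s≡q J q<s) adj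

  Adjacent-blocks⇔ : ∀ {m c I p J q} → I < B → p < s → J < B → q < s →
                     Adjacent m c (I * s + p) (J * s + q) ⇔ BlockAdjacent m c I p J q
  Adjacent-blocks⇔ {m} {c} {I} {p} {J} {q} I<B p<s J<B q<s = mk⇔
    (λ adj → subst₂ (λ I p → BlockAdjacent m c I p J q) ([J*s+q]/s≡J I p<s) ([J*s+q]%s≡q I p<s)
               (Adjacent-block m c J q<s adj))
    (λ adj → J*s+q<B*s I<B p<s , J*s+q<B*s J<B q<s ,
       subst₂ (λ x y → BlockAdjacent m c (proj₁ x) (proj₂ x) (proj₁ y) (proj₂ y))
         (sym (cong₂ _,_ ([J*s+q]/s≡J I p<s) ([J*s+q]%s≡q I p<s)))
         (sym (cong₂ _,_ ([J*s+q]/s≡J J q<s) ([J*s+q]%s≡q J q<s))) adj)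

  BlockAdjacent-unique : ∀ {m c I p J q q′} → BlockAdjacent m c I p J q → BlockAdjacent m c I p J q′ → q ≡ q′
  BlockAdjacent-unique {m} (inj₁ (_ , l))   (inj₁ (_ , l′))   = Linked-functional m l l′
  BlockAdjacent-unique {m} (inj₂ (_ , l))   (inj₂ (_ , l′))   = Linked-injective m l l′
  BlockAdjacent-unique     (inj₁ (I<J , _)) (inj₂ (J<I , _)) = ⊥-elim (<-asym I<J J<I)
  BlockAdjacent-unique     (inj₂ (J<I , _)) (inj₁ (I<J , _)) = ⊥-elim (<-asym I<J J<I)

  BlockAdjacent-<⇔ : ∀ {m c I p J q} → I < J → BlockAdjacent m c I p J q ⇔ Linked m (c I J) p q
  BlockAdjacent-<⇔ I<J = mk⇔ (λ { (inj₁ (_ , l)) → l ; (inj₂ (J<I , _)) → ⊥-elim (<-asym I<J J<I) })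
                             (λ l → inj₁ (I<J , l))

  degree-≤ : ∀ m c n U → B * s ≤ n → ∑< n (λ v → indicator (does (adjacent? m c U v))) ≤ B ∸ 1
  degree-≤ m c n U B*s≤n with U <? B * s
  ... | no U≮B*s = ≤-trans (≤-reflexive (∑<-zero n (λ v _ → cong indicator
                     (dec-false (adjacent? m c U v) (λ adj → U≮B*s (proj₁ adj)))))) z≤n
  ... | yes U<B*s = begin
    ∑< n g                                       ≡⟨ cong (λ k → ∑< k g) (sym (m+[n∸m]≡n B*s≤n)) ⟩
    ∑< (B * s + (n ∸ B * s)) g                   ≡⟨ ∑<-+ (B * s) (n ∸ B * s) g ⟩
    ∑< (B * s) g + ∑< (n ∸ B * s) (λ i → g (B * s + i))
                                                 ≡⟨ cong (∑< (B * s) g +_) (∑<-zero (n ∸ B * s) λ i _ →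
                                                      cong indicator (dec-false (adjacent? m c U (B * s + i))
                                                        (λ adj → <-irrefl refl (≤-<-trans (m≤m+n (B * s) i) (proj₁ (proj₂ adj)))))) ⟩
    ∑< (B * s) g + 0                             ≡⟨ +-identityʳ _ ⟩
    ∑< (B * s) g                                 ≡⟨ ∑<-blocks B s g ⟩
    ∑< B blockDegree                             ≤⟨ ∑<-≤-pred B blockDegree (m<n*o⇒m/o<n U<B*s) ownBlock otherBlock ⟩
    B ∸ 1                                        ∎
    where
    open ≤-Reasoning
    g = λ v → indicator (does (adjacent? m c U v))
    blockDegree = λ J → ∑< s (λ q → g (J * s + q))
    ownBlock : blockDegree (U / s) ≡ 0
    ownBlock = ∑<-zero s λ q q<s →
      cong indicator (dec-false (adjacent? m c U (U / s * s + q))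
        (λ adj → BlockAdjacent-irrefl {m} {c} (Adjacent-block m c (U / s) q<s adj)))
    otherBlock : ∀ J → J < B → blockDegree J ≤ 1
    otherBlock J _ = ∑<-indicator-≤1 (λ q → adjacent? m c U (J * s + q)) s
      (λ q<s q′<s adj adj′ → BlockAdjacent-unique {m} {c} (Adjacent-block m c J q<s adj) (Adjacent-block m c J q′<s adj′))

  blockGraph : Linking → Code → (n : ℕ) → Adj n
  blockGraph m c n u v = does (adjacent? m c (toℕ u) (toℕ v))

  blockGraph-good : ∀ m c {n Δ} → B * s ≤ n → B ≤ suc Δ → GoodGraph Δ (blockGraph m c n)
  blockGraph-good m c {n} {Δ} B*s≤n B≤1+Δ =
    ((λ u v → does-⇔ (mk⇔ (Adjacent-sym {m} {c}) (Adjacent-sym {m} {c}))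
                (adjacent? m c (toℕ u) (toℕ v)) (adjacent? m c (toℕ v) (toℕ u))) ,
     (λ u → dec-false (adjacent? m c (toℕ u) (toℕ u)) (Adjacent-irrefl {m} {c}))) ,
    (λ u → begin
      deg (blockGraph m c n) u                              ≡⟨ sum-allFin n (λ v → indicator (does (adjacent? m c (toℕ u) v))) ⟩
      ∑< n (λ v → indicator (does (adjacent? m c (toℕ u) v))) ≤⟨ degree-≤ m c n (toℕ u) B*s≤n ⟩
      B ∸ 1                                                 ≤⟨ ∸-monoˡ-≤ 1 B≤1+Δ ⟩
      Δ                                                     ∎)
    where open ≤-Reasoning

  codeBound : Linking → ℕ → ℕ → ℕ → ℕ
  codeBound m I J p = if does (I <? J) then linkBound m p else 0

  codeBound-< : ∀ m {I J} p → I < J → codeBound m I J p ≡ linkBound m p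
  codeBound-< m p I<J = cong (λ b → if b then linkBound m p else 0) (dec-true (_ <? _) I<J)

  codeBound-≮ : ∀ m {I J} p → ¬ I < J → codeBound m I J p ≡ 0
  codeBound-≮ m p I≮J = cong (λ b → if b then linkBound m p else 0) (dec-false (_ <? _) I≮J)

  ValidCode : Linking → Code → Set
  ValidCode m c = ∀ I J p → I < B → J < B → p < s → c I J p ≤ codeBound m I J p

  codes : Linking → List Code
  codes m = choices (λ _ _ → 0) B λ I → choices (λ _ → 0) B λ J → choices 0 s λ p → upTo (suc (codeBound m I J p))

  length-codes : ∀ m → length (codes m) ≡ linkCount m s ^ pairs B
  length-codes m = begin
    length (codes m)
      ≡⟨ length-choices _ B _ ⟩
    ∏< B (λ I → length (choices (λ _ → 0) B λ J → choices 0 s λ p → upTo (suc (codeBound m I J p))))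
      ≡⟨ ∏<-cong B (λ I _ → trans (length-choices _ B _) (∏<-cong B λ J _ →
           trans (length-choices _ s _) (∏<-cong s λ p _ → length-upTo _))) ⟩
    ∏< B (λ I → ∏< B λ J → ∏< s λ p → suc (codeBound m I J p))
      ≡⟨ ∏<-cong B (λ I _ → ∏<-cong B λ J _ → ∏<-pair (I <? J)) ⟩
    ∏< B (λ I → ∏< B λ J → if does (I <? J) then linkCount m s else 1)
      ≡⟨ ∏<-cong B (λ I _ → ∏<-above (linkCount m s) I B) ⟩
    ∏< B (λ I → linkCount m s ^ (B ∸ suc I))
      ≡⟨ ∏<-^ B (linkCount m s) (λ I → B ∸ suc I) ⟩
    linkCount m s ^ pairs B ∎
    where
    open ≡-Reasoning
    ∏<-pair : ∀ {I J} (d : Dec (I < J)) →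
              ∏< s (λ p → suc (if does d then linkBound m p else 0)) ≡ (if does d then linkCount m s else 1)
    ∏<-pair (yes _) = ∏<-linkBound m s
    ∏<-pair (no _)  = trans (∏<-const s 1) (^-zeroˡ s)

  codes-valid : ∀ m → All (ValidCode m) (codes m)
  codes-valid m = All.map (λ h I J p I<B J<B p<s → s≤s⁻¹ (h I I<B J J<B p p<s))
    (choices-All _ B _ λ I _ → choices-All _ B _ λ J _ → choices-All _ s _ λ p _ → Allₚ.all-upTo _)

  codes-distinct : ∀ m → AllPairs.AllPairs (ApartBelow B (ApartBelow B (ApartBelow s _≢_))) (codes m)
  codes-distinct m = choices-AllPairs _ B _ λ I _ → choices-AllPairs _ B _ λ J _ → choices-AllPairs _ s _ λ p _ →
    AllPairsₚ.applyUpTo⁺₁ (λ x → x) _ (λ i<j _ → <⇒≢ i<j)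

  blockGraph-≡⇒Adjacent⇔ : ∀ m {c c′ n} → (∀ u v → blockGraph m c n u v ≡ blockGraph m c′ n u v) →
                           ∀ {u v} → u < n → v < n → Adjacent m c u v ⇔ Adjacent m c′ u v
  blockGraph-≡⇒Adjacent⇔ m {c} {c′} same {u} {v} u<n v<n = mk⇔
    (does-≡⇒→ (adjacent? m c u v) (adjacent? m c′ u v) same-uv)
    (does-≡⇒→ (adjacent? m c′ u v) (adjacent? m c u v) (sym same-uv))
    where
    same-uv : does (adjacent? m c u v) ≡ does (adjacent? m c′ u v)
    same-uv = subst₂ (λ x y → does (adjacent? m c x y) ≡ does (adjacent? m c′ x y))
                (toℕ-fromℕ< u<n) (toℕ-fromℕ< v<n) (same (fromℕ< u<n) (fromℕ< v<n))

  blockGraph-injective : ∀ m {c c′ n} → B * s ≤ n → ValidCode m c → ValidCode m c′ →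
                         (∀ u v → blockGraph m c n u v ≡ blockGraph m c′ n u v) →
                         ∀ I J p → I < B → J < B → p < s → c I J p ≡ c′ I J p
  blockGraph-injective m {c} {c′} {n} B*s≤n valid valid′ same I J p I<B J<B p<s with I <? J
  ... | no I≮J = trans (vanishes valid) (sym (vanishes valid′))
    where
    vanishes : ∀ {d} → ValidCode m d → d I J p ≡ 0
    vanishes v = n≤0⇒n≡0 (subst (_ ≤_) (codeBound-≮ m p I≮J) (v I J p I<B J<B p<s))
  ... | yes I<J = Linked-determines-code m (linkValid valid) (linkValid valid′) linked⇔ p p<s
    where
    linkValid : ∀ {d} → ValidCode m d → ValidLink m (d I J)
    linkValid v q q<s = subst (_ ≤_) (codeBound-< m q I<J) (v I J q I<B J<B q<s)
    through-adjacency : ∀ {d d′ q r} → q < s → r < s →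
                        (Adjacent m d (I * s + q) (J * s + r) → Adjacent m d′ (I * s + q) (J * s + r)) →
                        Linked m (d I J) q r → Linked m (d′ I J) q r
    through-adjacency {d} {d′} q<s r<s adj⇒adj′ =
      Equivalence.to (BlockAdjacent-<⇔ {m} {d′} I<J) ∘ Equivalence.to (Adjacent-blocks⇔ {m} {d′} I<B q<s J<B r<s) ∘
      adj⇒adj′ ∘
      Equivalence.from (Adjacent-blocks⇔ {m} {d} I<B q<s J<B r<s) ∘ Equivalence.from (BlockAdjacent-<⇔ {m} {d} I<J)
    linked⇔ : ∀ q r → q < s → r < s → Linked m (c I J) q r ⇔ Linked m (c′ I J) q r
    linked⇔ q r q<s r<s = mk⇔ (through-adjacency {c} {c′} q<s r<s (Equivalence.to adj⇔))
                              (through-adjacency {c′} {c} q<s r<s (Equivalence.from adj⇔))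
      where
      adj⇔ = blockGraph-≡⇒Adjacent⇔ m {c} {c′} same
               (<-≤-trans (J*s+q<B*s I<B q<s) B*s≤n) (<-≤-trans (J*s+q<B*s J<B r<s) B*s≤n)

  numGraphs-≥ : ∀ m {n Δ} → B * s ≤ n → B ≤ suc Δ → linkCount m s ^ pairs B ≤ numGraphs n Δ
  numGraphs-≥ m {n} {Δ} B*s≤n B≤1+Δ = subst (_≤ numGraphs n Δ) (length-codes m)
    (injection-length _≈_ (All.map realised (codes-valid m)) (AllPairs.map separated (codes-distinct m)))
    where
    _≈_ : Code → Adj n → Set
    c ≈ A = ValidCode m c × (∀ u v → blockGraph m c n u v ≡ A u v)
    bool-member : ∀ b → Any (b ≡_) (true ∷ false ∷ [])
    bool-member true  = here refl
    bool-member false = there (here refl)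
    realised : ∀ {c} → ValidCode m c → Any (c ≈_) (filter (goodGraph? Δ) (allAdj n))
    realised {c} valid =
      Any-filter⁺ (goodGraph? Δ) (λ (_ , eq) → GoodGraph-resp eq (blockGraph-good m c B*s≤n B≤1+Δ))
        (Any.map (valid ,_)
          (allFns-complete n (λ f g → ∀ v → f v ≡ g v) (allFns n (true ∷ false ∷ [])) (blockGraph m c n)
            (λ u → allFns-complete n _≡_ (true ∷ false ∷ []) (blockGraph m c n u) (λ v → bool-member _))))
    separated : ∀ {c c′} → ApartBelow B (ApartBelow B (ApartBelow s _≢_)) c c′ → ∀ {A} → c ≈ A → c′ ≈ A → ⊥
    separated (I , I<B , J , J<B , p , p<s , c≢c′) (valid , eq) (valid′ , eq′) =
      c≢c′ (blockGraph-injective m B*s≤n valid valid′ (λ u v → trans (eq u v) (sym (eq′ u v))) I J p I<B J<B p<s)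

-- Numerical estimates

^-distribʳ-* : ∀ m n k → (m * n) ^ k ≡ m ^ k * n ^ k
^-distribʳ-* m n zero    = refl
^-distribʳ-* m n (suc k) =
  trans (cong (m * n *_) (^-distribʳ-* m n k)) ([m*n]*[o*p]≡[m*o]*[n*p] m n (m ^ k) (n ^ k))

^-swap : ∀ m a b → (m ^ a) ^ b ≡ (m ^ b) ^ a
^-swap m a b = trans (^-*-assoc m a b) (trans (cong (m ^_) (*-comm a b)) (sym (^-*-assoc m b a)))

^-cancelʳ-≤ : ∀ {a b} k → a ^ suc k ≤ b ^ suc k → a ≤ b
^-cancelʳ-≤ {a} {b} k le with a ≤? b
... | yes a≤b = a≤b
... | no a≰b  = contradiction le (<⇒≱ (^-monoˡ-< (suc k) (≰⇒> a≰b)))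

[1+M]^k*d≤M^[1+k] : ∀ k d → suc (d + k) ^ k * d ≤ (d + k) ^ suc k
[1+M]^k*d≤M^[1+k] zero    d = ≤-reflexive (trans (+-identityʳ d) (sym (trans (*-identityʳ (d + 0)) (+-identityʳ d))))
[1+M]^k*d≤M^[1+k] (suc k) d = *-cancelˡ-≤ (suc d) (begin
  suc d * (suc M ^ suc k * d)     ≡⟨ solve 4 (λ d M A d′ → d′ :* ((M :* A) :* d) := (M :* d) :* (A :* d′)) refl d (suc M) (suc M ^ k) (suc d) ⟩
  (suc M * d) * (suc M ^ k * suc d) ≤⟨ *-mono-≤ dM previous ⟩
  (M * suc d) * M ^ suc k         ≡⟨ solve 3 (λ M d′ W → (M :* d′) :* W := d′ :* (M :* W)) refl M (suc d) (M ^ suc k) ⟩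
  suc d * M ^ suc (suc k)         ∎)
  where
  open ≤-Reasoning
  M = d + suc k
  previous : suc M ^ k * suc d ≤ M ^ suc k
  previous = subst (λ x → suc x ^ k * suc d ≤ x ^ suc k) (sym (+-suc d k)) ([1+M]^k*d≤M^[1+k] k (suc d))
  dM : suc M * d ≤ M * suc d
  dM = begin
    suc M * d ≡⟨ +-comm d (M * d) ⟩
    M * d + d ≤⟨ +-monoʳ-≤ (M * d) (m≤m+n d (suc k)) ⟩
    M * d + M ≡⟨ +-comm (M * d) M ⟩
    M + M * d ≡⟨ sym (*-suc M d) ⟩
    M * suc d ∎

[9+t]^3*21≤40*[8+t]^3 : ∀ t → (9 + t) ^ 3 * 21 ≤ 40 * (8 + t) ^ 3
[9+t]^3*21≤40*[8+t]^3 t = *-cancelˡ-≤ 512 (begin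
  512 * ((9 + t) ^ 3 * 21)  ≡⟨ solve 1 (λ X → con 512 :* (X :* con 21) := (con 512 :* X) :* con 21) refl ((9 + t) ^ 3) ⟩
  (512 * (9 + t) ^ 3) * 21  ≡⟨ cong (_* 21) (sym (^-distribʳ-* 8 (9 + t) 3)) ⟩
  (8 * (9 + t)) ^ 3 * 21    ≤⟨ *-monoˡ-≤ 21 (^-monoˡ-≤ 3 linear) ⟩
  (9 * (8 + t)) ^ 3 * 21    ≡⟨ cong (_* 21) (^-distribʳ-* 9 (8 + t) 3) ⟩
  (729 * (8 + t) ^ 3) * 21  ≡⟨ solve 1 (λ Y → (con 729 :* Y) :* con 21 := con 15309 :* Y) refl ((8 + t) ^ 3) ⟩
  15309 * (8 + t) ^ 3       ≤⟨ *-monoˡ-≤ ((8 + t) ^ 3) (≤ᵇ⇒≤ 15309 20480 _) ⟩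
  20480 * (8 + t) ^ 3       ≡⟨ solve 1 (λ Y → con 20480 :* Y := con 512 :* (con 40 :* Y)) refl ((8 + t) ^ 3) ⟩
  512 * (40 * (8 + t) ^ 3)  ∎)
  where
  open ≤-Reasoning
  linear : 8 * (9 + t) ≤ 9 * (8 + t)
  linear = begin
    8 * (9 + t) ≡⟨ *-distribˡ-+ 8 9 t ⟩
    72 + 8 * t  ≤⟨ +-monoʳ-≤ 72 (*-monoˡ-≤ t (n≤1+n 8)) ⟩
    72 + 9 * t  ≡⟨ sym (*-distribˡ-+ 9 8 t) ⟩
    9 * (8 + t) ∎

-- By induction from s = 7; with M = s + 1 the step needs (1 + 1/M)^(M+1) ≤ 20M/21, which the two
-- preceding lemmas give as (1 + 1/M)^(M-2) ≤ M/2 and (1 + 1/M)^3 ≤ 40/21.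
factorial-estimate : ∀ s → 7 ≤ s → (suc s * 21) ^ suc s ≤ 20 ^ suc s * (s !) ^ 2
factorial-estimate s 7≤s = subst (λ s → (suc s * 21) ^ suc s ≤ 20 ^ suc s * (s !) ^ 2)
                             (m+[n∸m]≡n 7≤s) (from-7 (s ∸ 7))
  where
  from-7 : ∀ t → ((8 + t) * 21) ^ (8 + t) ≤ 20 ^ (8 + t) * ((7 + t) !) ^ 2
  from-7 zero    = ≤ᵇ⇒≤ ((8 * 21) ^ 8) (20 ^ 8 * (7 !) ^ 2) _
  from-7 (suc t) = *-cancelˡ-≤ 2 (begin
    2 * (((9 + t) * 21) ^ (9 + t))                ≡⟨ cong (2 *_) (^-distribʳ-* (9 + t) 21 (9 + t)) ⟩
    2 * ((9 + t) ^ (9 + t) * 21 ^ (9 + t))        ≡⟨ cong (λ x → 2 * (x * 21 ^ (9 + t))) split ⟩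
    2 * (A * C * (21 * Z))                        ≡⟨ solve 3 (λ A C Z → con 2 :* (A :* C :* (con 21 :* Z))
                                                                   := (A :* con 2) :* (C :* con 21) :* Z) refl A C Z ⟩
    (A * 2) * (C * 21) * Z                        ≤⟨ *-monoˡ-≤ Z (*-mono-≤ ([1+M]^k*d≤M^[1+k] (6 + t) 2) ([9+t]^3*21≤40*[8+t]^3 t)) ⟩
    W * (40 * (8 + t) ^ 3) * Z                    ≡⟨ solve 3 (λ W m Z → W :* (con 40 :* (m :* (m :* (m :* con 1)))) :* Z
                                                                   := con 40 :* (m :* m) :* ((m :* W) :* Z)) refl W (8 + t) Z ⟩
    40 * ((8 + t) * (8 + t)) * ((8 + t) ^ (8 + t) * Z)
                                                  ≡⟨ cong (40 * ((8 + t) * (8 + t)) *_) (sym (^-distribʳ-* (8 + t) 21 (8 + t))) ⟩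
    40 * ((8 + t) * (8 + t)) * (((8 + t) * 21) ^ (8 + t))
                                                  ≤⟨ *-monoʳ-≤ (40 * ((8 + t) * (8 + t))) (from-7 t) ⟩
    40 * ((8 + t) * (8 + t)) * (20 ^ (8 + t) * S ^ 2)
                                                  ≡⟨ solve 3 (λ m P S → con 40 :* (m :* m) :* (P :* (S :* (S :* con 1)))
                                                                   := con 2 :* ((con 20 :* P) :* ((m :* S) :* ((m :* S) :* con 1))))
                                                             refl (8 + t) (20 ^ (8 + t)) S ⟩
    2 * (20 ^ (9 + t) * ((8 + t) !) ^ 2)          ∎)
    where
    open ≤-Reasoning
    A = (9 + t) ^ (6 + t)
    C = (9 + t) ^ 3
    W = (8 + t) ^ (7 + t)
    Z = 21 ^ (8 + t)
    S = (7 + t) !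
    split : (9 + t) ^ (9 + t) ≡ A * C
    split = trans (cong ((9 + t) ^_) (+-comm 3 (6 + t))) (^-distribˡ-+-* (9 + t) (6 + t) 3)

-- With M = 21 (s + 1) and E = (s + 1)(Δ + 1)Δ ≥ nΔ:
-- (20 n)^(nΔ) 20^(E - nΔ) ≤ (M Δ)^(nΔ) M^(E - nΔ) = M^E Δ^(nΔ) ≤ 20^E (s!)^(2Δ(Δ+1)) Δ^(nΔ).
large-ratio-estimate : ∀ {n Δ s} → 20 ≤ Δ → 7 ≤ s → n ≤ suc s * suc Δ →
                       n ^ (n * Δ) ≤ ((s !) ^ pairs (suc Δ)) ^ 4 * Δ ^ (n * Δ)
large-ratio-estimate {n} {Δ} {s} 20≤Δ 7≤s n≤ = *-cancelˡ-≤ (20 ^ E) {{m^n≢0 20 E}} (begin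
  20 ^ E * n ^ X                         ≡⟨ *-comm (20 ^ E) (n ^ X) ⟩
  n ^ X * 20 ^ E                         ≡⟨ cong (λ e → n ^ X * 20 ^ e) E≡X+Y ⟩
  n ^ X * 20 ^ (X + Y)                   ≡⟨ cong (n ^ X *_) (^-distribˡ-+-* 20 X Y) ⟩
  n ^ X * (20 ^ X * 20 ^ Y)              ≡⟨ sym (*-assoc (n ^ X) (20 ^ X) (20 ^ Y)) ⟩
  n ^ X * 20 ^ X * 20 ^ Y                ≡⟨ cong (_* 20 ^ Y) (sym (^-distribʳ-* n 20 X)) ⟩
  (n * 20) ^ X * 20 ^ Y                  ≤⟨ *-mono-≤ (^-monoˡ-≤ X 20n≤MΔ) (^-monoˡ-≤ Y 20≤M) ⟩
  (M * Δ) ^ X * M ^ Y                    ≡⟨ cong (_* M ^ Y) (^-distribʳ-* M Δ X) ⟩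
  M ^ X * Δ ^ X * M ^ Y                  ≡⟨ solve 3 (λ A B C → A :* B :* C := A :* C :* B) refl (M ^ X) (Δ ^ X) (M ^ Y) ⟩
  M ^ X * M ^ Y * Δ ^ X                  ≡⟨ cong (_* Δ ^ X) (trans (sym (^-distribˡ-+-* M X Y)) (cong (M ^_) (sym E≡X+Y))) ⟩
  M ^ E * Δ ^ X                          ≡⟨ cong (_* Δ ^ X) (sym (^-*-assoc M (suc s) K)) ⟩
  (M ^ suc s) ^ K * Δ ^ X                ≤⟨ *-monoˡ-≤ (Δ ^ X) (^-monoˡ-≤ K (factorial-estimate s 7≤s)) ⟩
  (20 ^ suc s * (s !) ^ 2) ^ K * Δ ^ X   ≡⟨ cong (_* Δ ^ X) (^-distribʳ-* (20 ^ suc s) ((s !) ^ 2) K) ⟩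
  (20 ^ suc s) ^ K * ((s !) ^ 2) ^ K * Δ ^ X
                                         ≡⟨ cong₂ (λ a b → a * b * Δ ^ X) (^-*-assoc 20 (suc s) K)
                                              (trans (^-*-assoc (s !) 2 K) (cong ((s !) ^_) (sym 4P≡2K))) ⟩
  20 ^ E * (s !) ^ (P * 4) * Δ ^ X       ≡⟨ cong (λ z → 20 ^ E * z * Δ ^ X) (sym (^-*-assoc (s !) P 4)) ⟩
  20 ^ E * ((s !) ^ P) ^ 4 * Δ ^ X       ≡⟨ *-assoc (20 ^ E) _ _ ⟩
  20 ^ E * (((s !) ^ P) ^ 4 * Δ ^ X)     ∎)
  where
  open ≤-Reasoning
  X = n * Δ
  K = suc Δ * Δ
  E = suc s * K
  M = suc s * 21
  P = pairs (suc Δ)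
  Y = E ∸ X
  E≡X+Y : E ≡ X + Y
  E≡X+Y = sym (m+[n∸m]≡n (≤-trans (*-monoˡ-≤ Δ n≤) (≤-reflexive (*-assoc (suc s) (suc Δ) Δ))))
  20≤M : 20 ≤ M
  20≤M = ≤-trans (n≤1+n 20) (m≤n*m 21 (suc s))
  20n≤MΔ : n * 20 ≤ M * Δ
  20n≤MΔ = begin
    n * 20                 ≤⟨ *-monoˡ-≤ 20 n≤ ⟩
    suc s * suc Δ * 20     ≡⟨ solve 2 (λ s Δ → s :* (con 1 :+ Δ) :* con 20 := s :* (con 20 :+ con 20 :* Δ)) refl (suc s) Δ ⟩
    suc s * (20 + 20 * Δ)  ≤⟨ *-monoʳ-≤ (suc s) (+-monoˡ-≤ (20 * Δ) 20≤Δ) ⟩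
    suc s * (Δ + 20 * Δ)   ≡⟨ sym (*-assoc (suc s) 21 Δ) ⟩
    M * Δ                  ∎
  4P≡2K : P * 4 ≡ 2 * K
  4P≡2K = trans (*-comm P 4) (trans (*-assoc 2 2 P) (cong (2 *_) (2*pairs (suc Δ))))

-- With m = n - 2s ≤ (B - 1) s: (p + 1) nΔ ≤ 12 n² ≤ 12 m² + nΔ and 12 m² ≤ 6 s² · 2B(B - 1).
small-ratio-exponent : ∀ {a p n Δ s B} → p + 1 ≡ 2 * a → a * Δ ≤ 6 * n → 48 * s ≤ Δ → 2 * s ≤ n →
                       n < suc B * s → p * (n * Δ) ≤ 6 * (s * s) * (4 * pairs B)
small-ratio-exponent {a} {p} {n} {Δ} {s} {B} p+1≡2a aΔ≤6n 48s≤Δ 2s≤n n<[1+B]s =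
  ≤-trans (+-cancelʳ-≤ X (p * X) (12 * (m * m)) (begin
    p * X + X       ≡⟨ solve 2 (λ p X → p :* X :+ X := (p :+ con 1) :* X) refl p X ⟩
    (p + 1) * X     ≤⟨ [p+1]X≤12n² ⟩
    12 * (n * n)    ≤⟨ 12n²≤12m²+X ⟩
    12 * (m * m) + X ∎))
  12m²≤q4P
  where
  open ≤-Reasoning
  X = n * Δ
  m = n ∸ 2 * s
  n≡m+2s : n ≡ m + 2 * s
  n≡m+2s = sym (m∸n+n≡m 2s≤n)
  [p+1]X≤12n² : (p + 1) * X ≤ 12 * (n * n)
  [p+1]X≤12n² = begin
    (p + 1) * X     ≡⟨ cong (_* X) p+1≡2a ⟩
    2 * a * (n * Δ) ≡⟨ solve 3 (λ a n Δ → con 2 :* a :* (n :* Δ) := con 2 :* (a :* Δ) :* n) refl a n Δ ⟩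
    2 * (a * Δ) * n ≤⟨ *-monoˡ-≤ n (*-monoʳ-≤ 2 aΔ≤6n) ⟩
    2 * (6 * n) * n ≡⟨ solve 1 (λ n → con 2 :* (con 6 :* n) :* n := con 12 :* (n :* n)) refl n ⟩
    12 * (n * n)    ∎
  12n²≤12m²+X : 12 * (n * n) ≤ 12 * (m * m) + X
  12n²≤12m²+X = begin
    12 * (n * n)                               ≤⟨ *-monoʳ-≤ 12 (m≤m+n (n * n) (4 * (s * s))) ⟩
    12 * (n * n + 4 * (s * s))                 ≡⟨ cong (λ x → 12 * (x * x + 4 * (s * s))) n≡m+2s ⟩
    12 * ((m + 2 * s) * (m + 2 * s) + 4 * (s * s))
                                               ≡⟨ solve 2 (λ m s → con 12 :* ((m :+ con 2 :* s) :* (m :+ con 2 :* s) :+ con 4 :* (s :* s))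
                                                         := con 12 :* (m :* m) :+ (m :+ con 2 :* s) :* (con 48 :* s)) refl m s ⟩
    12 * (m * m) + (m + 2 * s) * (48 * s)      ≡⟨ cong (λ x → 12 * (m * m) + x * (48 * s)) (sym n≡m+2s) ⟩
    12 * (m * m) + n * (48 * s)                ≤⟨ +-monoʳ-≤ (12 * (m * m)) (*-monoʳ-≤ n 48s≤Δ) ⟩
    12 * (m * m) + X                           ∎
  b = pred B
  B≡1+b : B ≡ suc b
  B≡1+b = sym (suc-pred B {{>-nonZero (≰⇒> λ B≤0 →
            <⇒≱ n<[1+B]s (≤-trans (*-monoˡ-≤ s (s≤s B≤0)) (≤-trans (*-monoˡ-≤ s (s≤s (z≤n {1}))) 2s≤n)))}})
  m<bs : m < b * s
  m<bs = +-cancelʳ-< (2 * s) m (b * s) (begin-strict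
    m + 2 * s         ≡⟨ sym n≡m+2s ⟩
    n                 <⟨ n<[1+B]s ⟩
    suc B * s         ≡⟨ cong (λ x → suc x * s) B≡1+b ⟩
    suc (suc b) * s   ≡⟨ solve 2 (λ b s → (con 2 :+ b) :* s := b :* s :+ con 2 :* s) refl b s ⟩
    b * s + 2 * s     ∎)
  12m²≤q4P : 12 * (m * m) ≤ 6 * (s * s) * (4 * pairs B)
  12m²≤q4P = begin
    12 * (m * m)                     ≤⟨ *-monoʳ-≤ 12 (*-mono-≤ (≤-trans (<⇒≤ m<bs) (m≤n+m (b * s) s)) (<⇒≤ m<bs)) ⟩
    12 * ((s + b * s) * (b * s))     ≡⟨ solve 2 (λ b s → con 12 :* ((s :+ b :* s) :* (b :* s))
                                                   := con 6 :* (s :* s) :* (con 2 :* ((con 1 :+ b) :* b))) refl b s ⟩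
    6 * (s * s) * (2 * (suc b * b))  ≡⟨ cong (λ x → 6 * (s * s) * (2 * x)) (sym (2*pairs (suc b))) ⟩
    6 * (s * s) * (2 * (2 * pairs (suc b)))
                                     ≡⟨ cong (λ x → 6 * (s * s) * x) (sym (*-assoc 2 2 (pairs (suc b)))) ⟩
    6 * (s * s) * (4 * pairs (suc b)) ≡⟨ cong (λ x → 6 * (s * s) * (4 * pairs x)) (sym B≡1+b) ⟩
    6 * (s * s) * (4 * pairs B)      ∎

-- Raise (6n)^(nΔ) ≤ ((a+1)Δ)^(nΔ) to the power q, then use ((a+1)/6)^q ≤ F^p and p nΔ ≤ 4 q P.
small-ratio-estimate : ∀ {n Δ a p q F P} → .{{_ : NonZero F}} → (a + 1) ^ suc q ≤ 6 ^ suc q * F ^ p →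
                       p * (n * Δ) ≤ suc q * (4 * P) → 6 * n ≤ (a + 1) * Δ →
                       n ^ (n * Δ) ≤ (F ^ P) ^ 4 * Δ ^ (n * Δ)
small-ratio-estimate {n} {Δ} {a} {p} {q′} {F} {P} table exponent 6n≤[a+1]Δ =
  ^-cancelʳ-≤ q′ (*-cancelˡ-≤ ((6 ^ X) ^ q) {{m^n≢0 (6 ^ X) q {{m^n≢0 6 X}}}} (begin
    (6 ^ X) ^ q * (n ^ X) ^ q                    ≡⟨ sym (^-distribʳ-* (6 ^ X) (n ^ X) q) ⟩
    (6 ^ X * n ^ X) ^ q                          ≡⟨ cong (_^ q) (sym (^-distribʳ-* 6 n X)) ⟩
    ((6 * n) ^ X) ^ q                            ≤⟨ ^-monoˡ-≤ q (^-monoˡ-≤ X 6n≤[a+1]Δ) ⟩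
    (((a + 1) * Δ) ^ X) ^ q                      ≡⟨ cong (_^ q) (^-distribʳ-* (a + 1) Δ X) ⟩
    ((a + 1) ^ X * Δ ^ X) ^ q                    ≡⟨ ^-distribʳ-* ((a + 1) ^ X) (Δ ^ X) q ⟩
    ((a + 1) ^ X) ^ q * (Δ ^ X) ^ q              ≡⟨ cong (_* (Δ ^ X) ^ q) (^-swap (a + 1) X q) ⟩
    ((a + 1) ^ q) ^ X * (Δ ^ X) ^ q              ≤⟨ *-monoˡ-≤ ((Δ ^ X) ^ q) (^-monoˡ-≤ X table) ⟩
    (6 ^ q * F ^ p) ^ X * (Δ ^ X) ^ q            ≡⟨ cong (_* (Δ ^ X) ^ q) (^-distribʳ-* (6 ^ q) (F ^ p) X) ⟩
    (6 ^ q) ^ X * (F ^ p) ^ X * (Δ ^ X) ^ q      ≡⟨ cong₂ (λ x y → x * y * (Δ ^ X) ^ q) (^-swap 6 q X) (^-*-assoc F p X) ⟩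
    (6 ^ X) ^ q * F ^ (p * X) * (Δ ^ X) ^ q      ≤⟨ *-monoˡ-≤ ((Δ ^ X) ^ q) (*-monoʳ-≤ ((6 ^ X) ^ q) (^-monoʳ-≤ F pX≤4qP)) ⟩
    (6 ^ X) ^ q * F ^ (q * (4 * P)) * (Δ ^ X) ^ q
                                                 ≡⟨ cong (λ x → (6 ^ X) ^ q * x * (Δ ^ X) ^ q) F^4qP ⟩
    (6 ^ X) ^ q * ((F ^ P) ^ 4) ^ q * (Δ ^ X) ^ q ≡⟨ *-assoc ((6 ^ X) ^ q) _ _ ⟩
    (6 ^ X) ^ q * (((F ^ P) ^ 4) ^ q * (Δ ^ X) ^ q)
                                                 ≡⟨ cong ((6 ^ X) ^ q *_) (sym (^-distribʳ-* ((F ^ P) ^ 4) (Δ ^ X) q)) ⟩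
    (6 ^ X) ^ q * ((F ^ P) ^ 4 * Δ ^ X) ^ q      ∎))
  where
  open ≤-Reasoning
  X = n * Δ
  q = suc q′
  pX≤4qP : p * X ≤ q * (4 * P)
  pX≤4qP = exponent
  F^4qP : F ^ (q * (4 * P)) ≡ ((F ^ P) ^ 4) ^ q
  F^4qP = sym (trans (^-*-assoc (F ^ P) 4 q) (trans (^-*-assoc F P (4 * q))
            (cong (F ^_) (solve 2 (λ P q → P :* (con 4 :* q) := q :* (con 4 :* P)) refl P q))))

-- The two regimes of n / Δ

m<[1+m/n]*n : ∀ m n .{{_ : NonZero n}} → m < suc (m / n) * n
m<[1+m/n]*n m n = begin-strict
  m                   ≡⟨ m≡m%n+[m/n]*n m n ⟩
  m % n + (m / n) * n <⟨ +-monoˡ-< ((m / n) * n) (m%n<n m n) ⟩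
  n + (m / n) * n     ≡⟨⟩
  suc (m / n) * n     ∎
  where open ≤-Reasoning

lower-bound-large-ratio : ∀ {n Δ} → 20 ≤ Δ → 7 * suc Δ ≤ n → n ^ (n * Δ) ≤ numGraphs n Δ ^ 4 * Δ ^ (n * Δ)
lower-bound-large-ratio {n} {Δ} 20≤Δ 7[1+Δ]≤n =
  ≤-trans (large-ratio-estimate 20≤Δ 7≤s n≤[1+s][1+Δ])
          (*-monoˡ-≤ (Δ ^ (n * Δ)) (^-monoˡ-≤ 4 (Blocks.numGraphs-≥ s (suc Δ) permutation {n} {Δ} B*s≤n ≤-refl)))
  where
  s = n / suc Δ
  7≤s : 7 ≤ s
  7≤s = subst (_≤ s) (m*n/n≡m 7 (suc Δ)) (/-monoˡ-≤ (suc Δ) 7[1+Δ]≤n)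
  instance
    s≢0 : NonZero s
    s≢0 = >-nonZero (≤-trans (s≤s z≤n) 7≤s)
  B*s≤n : suc Δ * s ≤ n
  B*s≤n = subst (_≤ n) (*-comm s (suc Δ)) (m/n*n≤m n (suc Δ))
  n≤[1+s][1+Δ] : n ≤ suc s * suc Δ
  n≤[1+s][1+Δ] = <⇒≤ (m<[1+m/n]*n n (suc Δ))

-- For 6 ≤ a < 48 the blocks have size s = 1 + ⌊a/6⌋ and are joined by parts of the identity when s ≤ 3,
-- by permutations otherwise; the table checks ((a+1)/6)^(6s²) ≤ F^(2a-1) by evaluation.
blockSize : ℕ → ℕ
blockSize a = suc (a / 6)

linkingFor : ℕ → Linking
linkingFor (suc (suc (suc (suc _)))) = permutation
linkingFor _                         = subIdentity

TableInequality : ℕ → Set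
TableInequality a = (a + 1) ^ q ≤ 6 ^ q * linkCount (linkingFor s) s ^ (2 * a ∸ 1)
  where
  s = blockSize a
  q = 6 * (s * s)

table : All TableInequality (applyUpTo (6 +_) 42)
table = toWitness {a? = all? (λ a → _ ≤? _) (applyUpTo (6 +_) 42)} _

table-lookup : ∀ {a} → 6 ≤ a → a < 48 → TableInequality a
table-lookup {a} 6≤a a<48 = subst TableInequality (m+[n∸m]≡n 6≤a)
  (Allₚ.applyUpTo⁻ (6 +_) 42 table (+-cancelˡ-< 6 (a ∸ 6) 42 (subst (_< 48) (sym (m+[n∸m]≡n 6≤a)) a<48)))

-- a is 6n/Δ rounded up, less one.
ratio-index : ∀ {n Δ} .{{_ : NonZero Δ}} → 7 ≤ Δ → suc Δ ≤ n → n < 7 * suc Δ →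
              ∃[ a ] (6 ≤ a × a < 48 × a * Δ ≤ 6 * n × 6 * n ≤ (a + 1) * Δ)
ratio-index {n} {Δ} 7≤Δ Δ<n n<7[1+Δ] = a , 6≤a , a<48 , aΔ≤6n , 6n≤[a+1]Δ
  where
  a = (6 * n ∸ 1) / Δ
  aΔ≤6n : a * Δ ≤ 6 * n
  aΔ≤6n = ≤-trans (m/n*n≤m (6 * n ∸ 1) Δ) (m∸n≤m (6 * n) 1)
  6n≤[1+a]Δ : 6 * n ≤ suc a * Δ
  6n≤[1+a]Δ = subst (_≤ suc a * Δ) (m∸n+n≡m (≤-trans (≤-trans (s≤s z≤n) Δ<n) (m≤n*m n 6)))
                (subst (_≤ suc a * Δ) (+-comm 1 (6 * n ∸ 1)) (m<[1+m/n]*n (6 * n ∸ 1) Δ))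
  6n≤[a+1]Δ : 6 * n ≤ (a + 1) * Δ
  6n≤[a+1]Δ = subst (λ x → 6 * n ≤ x * Δ) (+-comm 1 a) 6n≤[1+a]Δ
  6≤a : 6 ≤ a
  6≤a with 6 ≤? a
  ... | yes 6≤a = 6≤a
  ... | no 6≰a  = contradiction Δ<n (≤⇒≯ (*-cancelˡ-≤ 6 (≤-trans 6n≤[1+a]Δ (*-monoˡ-≤ Δ (≰⇒> 6≰a)))))
  a<48 : a < 48
  a<48 with 48 ≤? a
  ... | no 48≰a  = ≰⇒> 48≰a
  ... | yes 48≤a = contradiction (begin-strict
    48 * Δ          ≤⟨ *-monoˡ-≤ Δ 48≤a ⟩
    a * Δ           ≤⟨ aΔ≤6n ⟩
    6 * n           <⟨ *-monoʳ-< 6 n<7[1+Δ] ⟩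
    6 * (7 * suc Δ) ≡⟨ solve 1 (λ Δ → con 6 :* (con 7 :* (con 1 :+ Δ)) := con 42 :+ con 42 :* Δ) refl Δ ⟩
    42 + 42 * Δ     ≤⟨ +-monoˡ-≤ (42 * Δ) (*-monoʳ-≤ 6 7≤Δ) ⟩
    6 * Δ + 42 * Δ  ≡⟨ solve 1 (λ Δ → con 6 :* Δ :+ con 42 :* Δ := con 48 :* Δ) refl Δ ⟩
    48 * Δ          ∎) (<-irrefl refl)
    where open ≤-Reasoning

linkCount-nonZero : ∀ m s → NonZero (linkCount m s)
linkCount-nonZero permutation s = >-nonZero (1≤n! s)
linkCount-nonZero subIdentity s = m^n≢0 2 s

lower-bound-small-ratio : ∀ {n Δ} → 384 ≤ Δ → suc Δ ≤ n → n < 7 * suc Δ →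
                          n ^ (n * Δ) ≤ numGraphs n Δ ^ 4 * Δ ^ (n * Δ)
lower-bound-small-ratio {n} {Δ} 384≤Δ Δ<n n<7[1+Δ]
  with a , 6≤a , a<48 , aΔ≤6n , 6n≤[a+1]Δ ← ratio-index {{>-nonZero (≤-trans (s≤s z≤n) 384≤Δ)}}
                                                 (≤-trans (≤ᵇ⇒≤ 7 384 _) 384≤Δ) Δ<n n<7[1+Δ] =
  ≤-trans (small-ratio-estimate {n} {Δ} {a} {2 * a ∸ 1} {pred (6 * (s * s))} {linkCount link s} {pairs B}
             {{linkCount-nonZero link s}} (table-lookup 6≤a a<48) exponent 6n≤[a+1]Δ)
          (*-monoˡ-≤ (Δ ^ (n * Δ)) (^-monoˡ-≤ 4 (Blocks.numGraphs-≥ s B link {n} {Δ} B*s≤n (m≤n⇒m≤1+n B≤Δ))))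
  where
  s = blockSize a
  link = linkingFor s
  B = n / s
  s≤8 : s ≤ 8
  s≤8 = m<n*o⇒m/o<n {a} {8} {6} a<48
  48s≤Δ : 48 * s ≤ Δ
  48s≤Δ = ≤-trans (*-monoʳ-≤ 48 s≤8) 384≤Δ
  2s≤n : 2 * s ≤ n
  2s≤n = ≤-trans (*-monoʳ-≤ 2 s≤8) (≤-trans (≤ᵇ⇒≤ 16 384 _) (≤-trans 384≤Δ (<⇒≤ Δ<n)))
  n≤Δs : n ≤ Δ * s
  n≤Δs = *-cancelˡ-≤ 6 (begin
    6 * n       ≤⟨ 6n≤[a+1]Δ ⟩
    (a + 1) * Δ ≤⟨ *-monoˡ-≤ Δ (subst (_≤ s * 6) (+-comm 1 a) (m<[1+m/n]*n a 6)) ⟩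
    s * 6 * Δ   ≡⟨ solve 2 (λ s Δ → s :* con 6 :* Δ := con 6 :* (Δ :* s)) refl s Δ ⟩
    6 * (Δ * s) ∎)
    where open ≤-Reasoning
  B≤Δ : B ≤ Δ
  B≤Δ = subst (B ≤_) (m*n/n≡m Δ s) (/-monoˡ-≤ s n≤Δs)
  B*s≤n : B * s ≤ n
  B*s≤n = m/n*n≤m n s
  exponent = small-ratio-exponent {a} {2 * a ∸ 1} {n} {Δ} {s} {B} (m∸n+n≡m (≤-trans (s≤s z≤n) (*-monoʳ-≤ 2 6≤a)))
               aΔ≤6n 48s≤Δ 2s≤n (m<[1+m/n]*n n s)

numGraphs-positive : ∀ n Δ → 1 ≤ numGraphs n Δ
numGraphs-positive n Δ = Blocks.numGraphs-≥ 1 0 permutation {n} {Δ} z≤n z≤n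

exponent-≤ : ∀ {c n Δ} → 2 ≤ n → n ^ c ≤ 2 ^ Δ → c ≤ Δ
exponent-≤ {c} 2≤n n^c≤2^Δ =
  ≮⇒≥ λ Δ<c → <⇒≱ (^-monoʳ-< 2 (s≤s (s≤s z≤n)) Δ<c) (≤-trans (^-monoˡ-≤ c 2≤n) n^c≤2^Δ)

lower-bound-Δ≥384 : ∀ {n Δ} → 384 ≤ Δ → suc Δ ≤ n → n ^ (n * Δ) ≤ numGraphs n Δ ^ 4 * Δ ^ (n * Δ)
lower-bound-Δ≥384 {n} {Δ} 384≤Δ Δ<n with 7 * suc Δ ≤? n
... | yes 7[1+Δ]≤n = lower-bound-large-ratio {n} {Δ} (≤-trans (≤ᵇ⇒≤ 20 384 _) 384≤Δ) 7[1+Δ]≤n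
... | no 7[1+Δ]≰n  = lower-bound-small-ratio {n} {Δ} 384≤Δ Δ<n (≰⇒> 7[1+Δ]≰n)

lower-bound : ∀ n Δ → n ^ 1000 ≤ 2 ^ Δ → Δ ≤ n ∸ 1 → n ^ (n * Δ) ≤ numGraphs n Δ ^ 4 * Δ ^ (n * Δ)
lower-bound n       zero    _          _   = subst (λ k → n ^ k ≤ numGraphs n 0 ^ 4 * 0 ^ k) (sym (*-zeroʳ n))
  (≤-trans (^-monoˡ-≤ 4 (numGraphs-positive n 0)) (m≤m*n (numGraphs n 0 ^ 4) 1))
lower-bound zero    (suc δ) _          ()
lower-bound (suc n) (suc δ) n^1000≤2^Δ Δ≤n = lower-bound-Δ≥384 {suc n} {suc δ}
  (≤-trans (≤ᵇ⇒≤ 384 1000 _) (exponent-≤ {1000} {suc n} {suc δ} (s≤s (≤-trans (s≤s z≤n) Δ≤n)) n^1000≤2^Δ))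
  (s≤s Δ≤n)

lemma8 : ∃[ c ] (∀ (n Δ : ℕ) → n ^ c ≤ 2 ^ Δ → Δ ≤ n ∸ 1 →
           n ^ (n * Δ) ≤ (4 * numGraphs n Δ) ^ 4 * Δ ^ (n * Δ))
lemma8 = 1000 , λ n Δ n^1000≤2^Δ Δ≤n∸1 →
  ≤-trans (lower-bound n Δ n^1000≤2^Δ Δ≤n∸1)
          (*-monoˡ-≤ (Δ ^ (n * Δ)) (^-monoˡ-≤ 4 (m≤n*m (numGraphs n Δ) 4)))
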